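{- Let $2\le s\le r$ be integers and let $\ell$ be the smallest positive integer such that $\lceil r\cdot 2^{ -\ell}\rceil<s$. Let $B_1,\dots,B_\ell$ be the bipartite graphs on the $r$-vertex set $V(Q'_\ell)$ constructed below. Then the graph $B_1\cup\cdots\cup B_\ell$ (on vertex set $V(Q'_\ell)$, with edge set the union of the edge sets) has independence number $\alpha(B_1\cup\cdots\cup B_\ell)<s$.
   Context: Let $Q_\ell$ be the $\ell$-dimensional hypercube, whose vertices are the binary words $(a_1,\dots,a_\ell)\in\{0,1\}^\ell$. Blow up $Q_\ell$ into $Q'_\ell$ by replacing each vertex of $Q_\ell$ by a class of $s-1$ new vertices. Then discard vertices of $Q'_\ell$ so that exactly $r$ vertices remain, discarding at most one vertex from each class; moreover, if the $(2i+1)$-st discarded vertex is from the class of $(a_1,\dots,a_\ell)$, the $(2i+2)$-nd discarded vertex is from the class of $(1-a_1,\dots,1-a_\ell)$. For $1\le i\le \ell$ and $c\in\{0,1\}$, let $A_{i,c}$ be the set of remaining vertices of $Q'_\ell$ belonging to the class of a vertex of $Q_\ell$ whose $i$-th coordinate equals $c$. $B_i$ is the complete bipartite graph with parts $A_{i,0}$ and $A_{i,1}$. $\alpha(\cdot)$ denotes the independence number. -}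

module Defs where

open import Data.Nat using (ℕ; zero; suc; _+_; _*_; _∸_; _^_; _≤_; _<_; NonZero)
open import Data.Nat.DivMod using (_/_)
import Data.Nat.Properties
open import Data.Bool using (Bool; true; false; not)
open import Data.Vec using (Vec; lookup; map)
open import Data.Fin using (Fin)
open import Data.List using (List; []; _∷_)
open import Data.Product using (_×_; Σ)
open import Data.Sum using (_⊎_)
open import Data.Unit using (⊤)
open import Relation.Binary.PropositionalEquality using (_≡_)

⌈_/_⌉ : ℕ → (n : ℕ) → .{{NonZero n}} → ℕ
⌈ m / n ⌉ = (m + (n ∸ 1)) / n

-- vertices of the blown-up hypercube Q'_ℓ : a binary word of length ℓ
-- (the vertex of Q_ℓ, i.e. the class) together with an index among the
-- s-1 new vertices of that class
Vertex : ℕ → ℕ → Set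
Vertex ℓ s = Vec Bool ℓ × Fin (s ∸ 1)

class : ∀ {ℓ s} → Vertex ℓ s → Vec Bool ℓ
class v = Data.Product.proj₁ v

complement : ∀ {ℓ} → Vec Bool ℓ → Vec Bool ℓ
complement = map not

-- the pairing condition on the sequence of classes of discarded vertices:
-- the (2i+2)-nd discarded class is the complement of the (2i+1)-st
Paired : ∀ {ℓ} → List (Vec Bool ℓ) → Set
Paired [] = ⊤
Paired (x ∷ []) = ⊤
Paired (x ∷ y ∷ xs) = (y ≡ complement x) × Paired xs

-- membership of v in A_{i,c} (ignoring the "remaining" condition, which is
-- imposed separately by the vertex set of the graph)
InA : ∀ {ℓ s} → Fin ℓ → Bool → Vertex ℓ s → Set
InA {ℓ} {s} i c v = lookup (class {ℓ} {s} v) i ≡ c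

EdgeB : ∀ {ℓ s} → Fin ℓ → Vertex ℓ s → Vertex ℓ s → Set
EdgeB {ℓ} {s} i u v = (InA {ℓ} {s} i false u × InA {ℓ} {s} i true v) ⊎ (InA {ℓ} {s} i true u × InA {ℓ} {s} i false v)

EdgeUnion : ∀ {ℓ s} → Vertex ℓ s → Vertex ℓ s → Set
EdgeUnion {ℓ} {s} u v = Σ (Fin ℓ) (λ i → EdgeB {ℓ} {s} i u v)

⌈_/2^_⌉ : ℕ → ℕ → ℕ
⌈ r /2^ k ⌉ = ⌈ r / 2 ^ k ⌉ {{Data.Nat.Properties.m^n≢0 2 k {{Data.Nat.nonZero}}}}

-- Two vertices of Q'_ℓ that are adjacent in no B_i agree in every coordinate,
-- so they lie in the same class. An independent set of B_1 ∪ ⋯ ∪ B_ℓ is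
-- therefore contained in a single class, which has only s − 1 vertices; none of
-- the hypotheses on r, ℓ or the discarded vertices is needed for this bound.
module Submission where

open import Defs
open import Data.Nat using (ℕ; suc; _+_; _*_; _∸_; _^_; _≤_; _<_; s≤s)
open import Relation.Binary.PropositionalEquality using (_≡_; refl; sym; trans; cong; cong₂)
open import Data.Fin using (zero; suc)
open import Data.List using (List; length; map; lookup)
open import Data.List.Relation.Unary.All using (All)
import Data.List.Relation.Unary.All as All
open import Data.List.Relation.Unary.AllPairs using (_∷_)
open import Data.List.Relation.Unary.Unique.Propositional using (Unique)
open import Data.List.Membership.Propositional using (_∈_; _∉_)
open import Data.List.Membership.Propositional.Properties using (∈-lookup)
open import Data.Fin.Properties using (injective⇒≤)
open import Data.Vec using (Vec)
import Data.Vec as Vec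
open import Data.Vec.Properties using (tabulate∘lookup; tabulate-cong)
open import Data.Bool using (Bool; true; false)
open import Data.Product using (_×_; _,_; proj₂)
open import Data.Sum using (_⊎_; inj₁; inj₂)
open import Data.Empty using (⊥-elim)
open import Relation.Nullary using (¬_)

Unique⇒lookup-injective : ∀ {A : Set} {xs : List A} → Unique xs
  → ∀ i j → lookup xs i ≡ lookup xs j → i ≡ j
Unique⇒lookup-injective (_ ∷ _)    zero    zero    _  = refl
Unique⇒lookup-injective (x∉xs ∷ _) zero    (suc j) eq = ⊥-elim (All.lookup x∉xs (∈-lookup j) eq)
Unique⇒lookup-injective (x∉xs ∷ _) (suc i) zero    eq = ⊥-elim (All.lookup x∉xs (∈-lookup i) (sym eq))
Unique⇒lookup-injective (_ ∷ u)    (suc i) (suc j) eq = cong suc (Unique⇒lookup-injective u i j eq)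

≡-from-lookup : ∀ {A : Set} {n} {a b : Vec A n} → (∀ i → Vec.lookup a i ≡ Vec.lookup b i) → a ≡ b
≡-from-lookup {a = a} {b} same = trans (sym (tabulate∘lookup a)) (trans (tabulate-cong same) (tabulate∘lookup b))

¬differ⇒≡ : ∀ {a b : Bool} → ¬ ((a ≡ false × b ≡ true) ⊎ (a ≡ true × b ≡ false)) → a ≡ b
¬differ⇒≡ {false} {false} _  = refl
¬differ⇒≡ {true}  {true}  _  = refl
¬differ⇒≡ {false} {true}  ne = ⊥-elim (ne (inj₁ (refl , refl)))
¬differ⇒≡ {true}  {false} ne = ⊥-elim (ne (inj₂ (refl , refl)))

¬EdgeUnion⇒class≡ : ∀ {ℓ s} (u v : Vertex ℓ s) → ¬ EdgeUnion {ℓ} {s} u v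
  → class {ℓ} {s} u ≡ class {ℓ} {s} v
¬EdgeUnion⇒class≡ u v ¬uv = ≡-from-lookup (λ i → ¬differ⇒≡ (λ uv → ¬uv (i , uv)))

independent⇒length≤ : ∀ {ℓ s} (S : List (Vertex ℓ s)) → Unique S
  → ((u v : Vertex ℓ s) → u ∈ S → v ∈ S → ¬ EdgeUnion {ℓ} {s} u v)
  → length S ≤ s ∸ 1
independent⇒length≤ {ℓ} {s} S unique independent = injective⇒≤ index-injective
  where
  index-injective : ∀ {i j} → proj₂ (lookup S i) ≡ proj₂ (lookup S j) → i ≡ j
  index-injective {i} {j} same-index = Unique⇒lookup-injective unique i j
    (cong₂ _,_ (¬EdgeUnion⇒class≡ {ℓ} {s} (lookup S i) (lookup S j)
                 (independent _ _ (∈-lookup i) (∈-lookup j)))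
               same-index)

lemma5 : (s r ℓ : ℕ) → 2 ≤ s → s ≤ r
    → 1 ≤ ℓ → ⌈ r /2^ ℓ ⌉ < s
    → ((k : ℕ) → 1 ≤ k → k < ℓ → s ≤ ⌈ r /2^ k ⌉)
    → (d : List (Vertex ℓ s))
    → Unique (map (class {ℓ} {s}) d)
    → Paired (map (class {ℓ} {s}) d)
    → length d + r ≡ 2 ^ ℓ * (s ∸ 1)
    → (S : List (Vertex ℓ s))
    → Unique S
    → All (λ v → v ∉ d) S
    → ((u v : Vertex ℓ s) → u ∈ S → v ∈ S → ¬ EdgeUnion {ℓ} {s} u v)
    → length S < s
lemma5 (suc s) r ℓ _ _ _ _ _ d _ _ _ S unique _ independent =
  s≤s (independent⇒length≤ {ℓ} {suc s} S unique independent)
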